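{- Let $\ell, k$ be integers with $2\ell+1 \le k \le 4\ell+1$. If $G$ is an oriented graph containing no copy of $C_k^\ell$, then for every $t \ge 1$ the $t$-blow-up of $G$ also contains no copy of $C_k^\ell$.
   Context: An oriented graph is a loopless directed graph with at most one of $uv$, $vu$ for each pair of distinct vertices. $C_k^\ell$ is the $\ell$-th power of the consistently oriented cycle on $k$ vertices: vertices $v_1,\dots,v_k$ with an edge $v_iv_j$ whenever $j-i \in\{1,\dots,\ell\}$ modulo $k$. For an oriented graph $G$ with $V(G)=[n]$, its $t$-blow-up $G_t$ has vertex set partitioned into sets $V_1,\dots,V_n$ of size $t$, with $ab \in E(G_t)$ if and only if $a\in V_i$, $b\in V_j$ and $ij \in E(G)$. -}

module Defs where

open import Data.Nat using (ℕ; suc; _+_; _≤_; _%_; NonZero)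
open import Data.Fin using (Fin; toℕ)
open import Data.Product using (_×_; Σ; ∃; _,_)
open import Relation.Nullary using (¬_)
open import Relation.Binary.PropositionalEquality using (_≡_)
open import Function.Definitions using (Injective)
open import Level using (0ℓ; suc)

record OrientedGraph (n : ℕ) : Set₁ where
  field
    E         : Fin n → Fin n → Set
    loopless  : ∀ u → ¬ E u u
    asym      : ∀ u v → E u v → ¬ E v u

Contains : {A B : Set} → (B → B → Set) → (A → A → Set) → Set
Contains {A} {B} EG EH =
  Σ (A → B) λ f → Injective _≡_ _≡_ f × (∀ u v → EH u v → EG (f u) (f v))

-- C_k^ℓ on vertices Fin k (v_1..v_k ↦ 0..k-1): edge i→j iff j - i ≡ d (mod k)
-- for some d ∈ {1,…,ℓ}.
CycPowE : (k ℓ : ℕ) → .{{_ : NonZero k}} → Fin k → Fin k → Set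
CycPowE k ℓ i j =
  ∃ λ d → 1 ≤ d × d ≤ ℓ × (toℕ i + d) % k ≡ toℕ j

-- t-blow-up of G: vertices (i , a) with i ∈ [n], a ∈ [t] (V_i = {i} × [t]);
-- (i , a)(j , b) is an edge iff ij ∈ E(G).
BlowUpE : {n : ℕ} → OrientedGraph n → (t : ℕ) → Fin n × Fin t → Fin n × Fin t → Set
BlowUpE G t (i , _) (j , _) = OrientedGraph.E G i j

{-# OPTIONS --safe #-}
module Submission where

-- A homomorphic image of C_k^ℓ in an oriented graph is already a copy of it
-- when k ≤ 4ℓ + 1.  Two distinct vertices of C_k^ℓ are at cyclic distance
-- d ≤ 2ℓ in one direction.  If d ≤ ℓ they are adjacent, so identifying them
-- creates a loop; if ℓ < d they are joined by a path of two edges of lengths ℓ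
-- and d − ℓ, so identifying them creates a 2-cycle.  Hence every
-- edge-preserving map C_k^ℓ → G is injective, and composing a copy of C_k^ℓ in
-- the blow-up with the projection G_t → G yields a copy in G.

open import Defs
open import Data.Nat using (ℕ; _+_; _*_; _≤_; _<_; _∸_; _%_; NonZero)
open import Data.Nat.Properties hiding (<-cmp)
open import Data.Nat.DivMod using (%-distribˡ-+; m%n%n≡m%n; [m+n]%n≡m%n; m<n⇒m%n≡m; m%n<n)
open import Data.Fin using (Fin; toℕ; fromℕ<)
open import Data.Fin.Properties using (toℕ-fromℕ<; toℕ<n; <-cmp)
open import Data.Product using (_×_; ∃; _,_; proj₁)
open import Data.Sum using (_⊎_; inj₁; inj₂)
open import Data.Empty using (⊥-elim)
open import Relation.Nullary using (¬_; yes; no)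
open import Relation.Binary.Definitions using (Asymmetric; tri<; tri≈; tri>)
open import Relation.Binary.PropositionalEquality
open import Function.Base using (_∘_)
open import Function.Definitions using (Injective)
open import Data.Nat.Tactic.RingSolver using (solve-∀)

[m%n+o]%n≡[m+o]%n : ∀ m o n .{{_ : NonZero n}} → (m % n + o) % n ≡ (m + o) % n
[m%n+o]%n≡[m+o]%n m o n = begin
  (m % n + o) % n          ≡⟨ %-distribˡ-+ (m % n) o n ⟩
  (m % n % n + o % n) % n  ≡⟨ cong (λ r → (r + o % n) % n) (m%n%n≡m%n m n) ⟩
  (m % n + o % n) % n      ≡⟨ %-distribˡ-+ m o n ⟨
  (m + o) % n              ∎
  where open ≡-Reasoning

4ℓ+1≡1+2ℓ+2ℓ : ∀ ℓ → 4 * ℓ + 1 ≡ 1 + 2 * ℓ + 2 * ℓ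
4ℓ+1≡1+2ℓ+2ℓ = solve-∀

Ahead : (k : ℕ) → .{{_ : NonZero k}} → ℕ → Fin k → Fin k → Set
Ahead k d i j = (toℕ i + d) % k ≡ toℕ j

module _ {k : ℕ} .{{_ : NonZero k}} where

  ahead-split : ∀ {a d} {i j : Fin k} → a ≤ d → Ahead k d i j →
    ∃ λ w → Ahead k a i w × Ahead k (d ∸ a) w j
  ahead-split {a} {d} {i} {j} a≤d i→j = w , i→w , w→j
    where
    w : Fin k
    w = fromℕ< (m%n<n (toℕ i + a) k)
    i→w : Ahead k a i w
    i→w = sym (toℕ-fromℕ< (m%n<n (toℕ i + a) k))
    w→j : Ahead k (d ∸ a) w j
    w→j = begin
      (toℕ w + (d ∸ a)) % k            ≡⟨ cong (λ r → (r + (d ∸ a)) % k) i→w ⟨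
      ((toℕ i + a) % k + (d ∸ a)) % k  ≡⟨ [m%n+o]%n≡[m+o]%n (toℕ i + a) (d ∸ a) k ⟩
      (toℕ i + a + (d ∸ a)) % k        ≡⟨ cong (_% k) (+-assoc (toℕ i) a (d ∸ a)) ⟩
      (toℕ i + (a + (d ∸ a))) % k      ≡⟨ cong (λ r → (toℕ i + r) % k) (m+[n∸m]≡n a≤d) ⟩
      (toℕ i + d) % k                  ≡⟨ i→j ⟩
      toℕ j                            ∎
      where open ≡-Reasoning

  ahead-forward : ∀ {i j : Fin k} → toℕ i < toℕ j → Ahead k (toℕ j ∸ toℕ i) i j
  ahead-forward {i} {j} i<j = begin
    (toℕ i + (toℕ j ∸ toℕ i)) % k  ≡⟨ cong (_% k) (m+[n∸m]≡n (<⇒≤ i<j)) ⟩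
    toℕ j % k                      ≡⟨ m<n⇒m%n≡m (toℕ<n j) ⟩
    toℕ j                          ∎
    where open ≡-Reasoning

  ahead-backward : ∀ {i j : Fin k} → toℕ i < toℕ j → Ahead k (k ∸ (toℕ j ∸ toℕ i)) j i
  ahead-backward {i} {j} i<j = begin
    (toℕ j + (k ∸ d)) % k        ≡⟨ cong (λ r → (r + (k ∸ d)) % k) (m+[n∸m]≡n (<⇒≤ i<j)) ⟨
    (toℕ i + d + (k ∸ d)) % k    ≡⟨ cong (_% k) (+-assoc (toℕ i) d (k ∸ d)) ⟩
    (toℕ i + (d + (k ∸ d))) % k  ≡⟨ cong (λ r → (toℕ i + r) % k) (m+[n∸m]≡n d≤k) ⟩
    (toℕ i + k) % k              ≡⟨ [m+n]%n≡m%n (toℕ i) k ⟩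
    toℕ i % k                    ≡⟨ m<n⇒m%n≡m (toℕ<n i) ⟩
    toℕ i                        ∎
    where
    open ≡-Reasoning
    d = toℕ j ∸ toℕ i
    d≤k : d ≤ k
    d≤k = ≤-trans (m∸n≤m (toℕ j) (toℕ i)) (<⇒≤ (toℕ<n j))

  ahead-within-2ℓ : ∀ ℓ {i j : Fin k} → k ≤ 4 * ℓ + 1 → toℕ i < toℕ j →
    ∃ λ d → 1 ≤ d × d ≤ 2 * ℓ × (Ahead k d i j ⊎ Ahead k d j i)
  ahead-within-2ℓ ℓ {i} {j} k≤4ℓ+1 i<j with toℕ j ∸ toℕ i ≤? 2 * ℓ
  ... | yes d≤2ℓ = toℕ j ∸ toℕ i , m<n⇒0<n∸m i<j , d≤2ℓ , inj₁ (ahead-forward i<j)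
  ... | no d≰2ℓ = k ∸ d , m<n⇒0<n∸m d<k , k∸d≤2ℓ , inj₂ (ahead-backward i<j)
    where
    d = toℕ j ∸ toℕ i
    d<k : d < k
    d<k = ≤-<-trans (m∸n≤m (toℕ j) (toℕ i)) (toℕ<n j)
    k∸d≤2ℓ : k ∸ d ≤ 2 * ℓ
    k∸d≤2ℓ = m≤n+o⇒m∸n≤o k d (begin
      k                  ≤⟨ k≤4ℓ+1 ⟩
      4 * ℓ + 1          ≡⟨ 4ℓ+1≡1+2ℓ+2ℓ ℓ ⟩
      1 + 2 * ℓ + 2 * ℓ  ≤⟨ +-monoˡ-≤ (2 * ℓ) (≰⇒> d≰2ℓ) ⟩
      d + 2 * ℓ          ∎)
      where open ≤-Reasoning

module _ {V : Set} {E : V → V → Set} (asym : Asymmetric E)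
         {k ℓ : ℕ} .{{_ : NonZero k}} {g : Fin k → V}
         (hom : ∀ u v → CycPowE k ℓ u v → E (g u) (g v)) where

  cycPow-hom-separates-ahead : ∀ {d} {i j : Fin k} → 1 ≤ d → d ≤ 2 * ℓ → Ahead k d i j → g i ≢ g j
  cycPow-hom-separates-ahead {d} {i} {j} 1≤d d≤2ℓ i→j gi≡gj with d ≤? ℓ
  ... | yes d≤ℓ = asym gi⇒gi gi⇒gi
    where
    gi⇒gi : E (g i) (g i)
    gi⇒gi = subst (E (g i)) (sym gi≡gj) (hom i j (d , 1≤d , d≤ℓ , i→j))
  ... | no d≰ℓ with ahead-split (<⇒≤ (≰⇒> d≰ℓ)) i→j
  ... | w , i→w , w→j = asym gi⇒gw (subst (E (g w)) (sym gi≡gj) gw⇒gj)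
    where
    1≤d∸ℓ : 1 ≤ d ∸ ℓ
    1≤d∸ℓ = m<n⇒0<n∸m (≰⇒> d≰ℓ)
    d∸ℓ≤ℓ : d ∸ ℓ ≤ ℓ
    d∸ℓ≤ℓ = m≤n+o⇒m∸n≤o d ℓ (subst (d ≤_) (cong (ℓ +_) (+-identityʳ ℓ)) d≤2ℓ)
    gi⇒gw : E (g i) (g w)
    gi⇒gw = hom i w (ℓ , ≤-trans 1≤d∸ℓ d∸ℓ≤ℓ , ≤-refl , i→w)
    gw⇒gj : E (g w) (g j)
    gw⇒gj = hom w j (d ∸ ℓ , 1≤d∸ℓ , d∸ℓ≤ℓ , w→j)

  cycPow-hom-separates : k ≤ 4 * ℓ + 1 → ∀ {i j : Fin k} → toℕ i < toℕ j → g i ≢ g j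
  cycPow-hom-separates k≤4ℓ+1 i<j with ahead-within-2ℓ ℓ k≤4ℓ+1 i<j
  ... | d , 1≤d , d≤2ℓ , inj₁ i→j = cycPow-hom-separates-ahead 1≤d d≤2ℓ i→j
  ... | d , 1≤d , d≤2ℓ , inj₂ j→i = cycPow-hom-separates-ahead 1≤d d≤2ℓ j→i ∘ sym

  cycPow-hom-injective : k ≤ 4 * ℓ + 1 → Injective _≡_ _≡_ g
  cycPow-hom-injective k≤4ℓ+1 {i} {j} gi≡gj with <-cmp i j
  ... | tri< i<j _ _ = ⊥-elim (cycPow-hom-separates k≤4ℓ+1 i<j gi≡gj)
  ... | tri≈ _ i≡j _ = i≡j
  ... | tri> _ _ j<i = ⊥-elim (cycPow-hom-separates k≤4ℓ+1 j<i (sym gi≡gj))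

claim4p1 : (ℓ k : ℕ) → .{{_ : NonZero k}} → 2 * ℓ + 1 ≤ k → k ≤ 4 * ℓ + 1 →
    (n : ℕ) → (G : OrientedGraph n) →
    ¬ Contains (OrientedGraph.E G) (CycPowE k ℓ) →
    (t : ℕ) → 1 ≤ t →
    ¬ Contains (BlowUpE G t) (CycPowE k ℓ)
claim4p1 ℓ k _ k≤4ℓ+1 n G no-copy t _ (f , _ , f-hom) =
  no-copy (proj₁ ∘ f , cycPow-hom-injective (λ {u} {v} → asym u v) f-hom k≤4ℓ+1 , f-hom)
  where open OrientedGraph G
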